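{- Let $k\in\{2,3\}$ and $\mathrm{Ag}=\{1,\dots,k\}$. For every ATL formula $\phi$ with $k$ agents over $\{p,\bar p\}$, the three formulas $\phi$, $\langle\!\langle\emptyset\rangle\!\rangle\mathbf{F}\phi$ and $\langle\!\langle\mathrm{Ag}\rangle\!\rangle\mathbf{G}\phi$ are satisfied by exactly the same states of every self-looping $\mathrm{Ag}$-turn-based structure.
   Context: An $\mathrm{Ag}$-turn-based structure is $\langle Q,I,\mathsf{Prop},\pi,\mathrm{AgSt},\mathrm{Succ}\rangle$ with finite $Q$, initial states $I$, labelling $\pi$, owner map $\mathrm{AgSt}:Q\to\mathrm{Ag}$ and nonempty successor sets $\mathrm{Succ}(q)$; it is the concurrent game structure in which at $q$ agent $\mathrm{AgSt}(q)$ picks the next state in $\mathrm{Succ}(q)$ and the other agents have one action. It is $(0,\emptyset)$-proper if $\mathsf{Prop}=\{p,\bar p\}$ and every state is labelled exactly $\{p\}$ or $\{\bar p\}$; it is self-looping if it is $(0,\emptyset)$-proper and $q\in\mathrm{Succ}(q)$ for every state $q$. ATL semantics: $q\models\langle\!\langle A\rangle\!\rangle\psi$ iff some strategy profile of coalition $A$ (strategies map histories to actions) makes every consistent infinite path $\rho$ from $q$ satisfy $\psi$; $\rho\models\mathbf{F}\phi$ iff some $\rho[i]\models\phi$, $\rho\models\mathbf{G}\phi$ iff all $\rho[i]\models\phi$. -}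

module Defs where

open import Data.Nat using (ℕ; zero; suc; _<_)
import Data.Unit
open import Data.Fin using (Fin)
open import Data.Fin.Subset using (Subset; _∈_; Nonempty)
open import Data.Bool using (Bool; true; false)
open import Data.List using (List; map; upTo)
open import Data.Product using (Σ; _×_; _,_; proj₁; proj₂)
open import Data.Sum using (_⊎_)
open import Relation.Binary.PropositionalEquality using (_≡_; refl)
open import Relation.Nullary using (¬_)

data AP : Set where
  p  : AP
  p̄ : AP

Agent : ℕ → Set
Agent k = Fin k

Coalition : ℕ → Set
Coalition k = Subset k

-- Ag-turn-based structure ⟨Q, I, Prop, π, AgSt, Succ⟩ with Q = Fin n.
record TBS (k : ℕ) : Set where
  field
    n         : ℕ
    I         : Subset n
    π         : Fin n → AP → Bool          -- π q a ≡ true  iff  a ∈ π(q)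
    AgSt      : Fin n → Agent k
    Succ      : Fin n → Subset n
    Succ-ne   : (q : Fin n) → Nonempty (Succ q)

module _ {k : ℕ} (M : TBS k) where
  open TBS M

  State : Set
  State = Fin n

  Proper : Set
  Proper = (q : State) →
             (π q p ≡ true × π q p̄ ≡ false) ⊎ (π q p ≡ false × π q p̄ ≡ true)

  SelfLooping : Set
  SelfLooping = Proper × ((q : State) → q ∈ Succ q)

  History : Set
  History = List State × State

  -- Strategy of agent a in the induced concurrent game structure: at a
  -- history whose current state is owned by a, it picks a successor; at
  -- other states agent a has a single action, so no choice is recorded.
  Strategy : Agent k → Set
  Strategy a = (h : History) → AgSt (proj₂ h) ≡ a →
               Σ State (λ q′ → q′ ∈ Succ (proj₂ h))

  Profile : Coalition k → Set
  Profile A = (a : Agent k) → a ∈ A → Strategy a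

  Path : Set
  Path = ℕ → State

  prefix : Path → ℕ → History
  prefix ρ i = (map ρ (upTo i) , ρ i)

  Consistent : (A : Coalition k) → Profile A → State → Path → Set
  Consistent A σ q ρ =
      (ρ 0 ≡ q)
    × ((i : ℕ) → ρ (suc i) ∈ Succ (ρ i))
    × ((i : ℕ) (m : AgSt (ρ i) ∈ A) →
         ρ (suc i) ≡ proj₁ (σ (AgSt (ρ i)) m (prefix ρ i) refl))

data Formula (k : ℕ) : Set where
  atom  : AP → Formula k
  tt    : Formula k
  ¬'_   : Formula k → Formula k
  _∧'_  : Formula k → Formula k → Formula k
  ⟪_⟫X_ : Coalition k → Formula k → Formula k
  ⟪_⟫F_ : Coalition k → Formula k → Formula k
  ⟪_⟫G_ : Coalition k → Formula k → Formula k
  ⟪_⟫_U_ : Coalition k → Formula k → Formula k → Formula k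

module _ {k : ℕ} (M : TBS k) where
  open TBS M

  Enforce : Coalition k → State M → (Path M → Set) → Set
  Enforce A q ψ = Σ (Profile M A) λ σ →
                    (ρ : Path M) → Consistent M A σ q ρ → ψ ρ

  _⊨_ : State M → Formula k → Set
  q ⊨ atom a = π q a ≡ true
  q ⊨ tt = Data.Unit.⊤
  q ⊨ (¬' φ) = ¬ (q ⊨ φ)
  q ⊨ (φ ∧' ψ) = (q ⊨ φ) × (q ⊨ ψ)
  q ⊨ (⟪ A ⟫X φ) = Enforce A q (λ ρ → ρ 1 ⊨ φ)
  q ⊨ (⟪ A ⟫F φ) = Enforce A q (λ ρ → Σ ℕ λ i → ρ i ⊨ φ)
  q ⊨ (⟪ A ⟫G φ) = Enforce A q (λ ρ → (i : ℕ) → ρ i ⊨ φ)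
  q ⊨ (⟪ A ⟫ φ U ψ) = Enforce A q (λ ρ → Σ ℕ λ i →
                          (ρ i ⊨ ψ) × ((j : ℕ) → j < i → ρ j ⊨ φ))

-- In a self-looping structure every state can be kept forever: the empty
-- coalition cannot prevent the constant path, so ⟪∅⟫F φ already forces φ now,
-- and the grand coalition can enforce the constant path by always looping,
-- so φ gives ⟪Ag⟫G φ. The converse directions hold because the current state
-- is the first state of every outcome, and every profile has an outcome.

module Submission where

open import Defs
open import Data.Nat using (ℕ; zero; suc)
open import Data.Fin.Subset using (⊤; ⊥; _∈_)
open import Data.Fin.Subset.Properties using (∈⊤; ∉⊥; _∈?_)
open import Data.Vec.Properties.WithK using ([]=-irrelevant)
open import Data.List using ([]; _∷ʳ_; map; upTo)
open import Data.List.Properties using (map-++; upTo-∷ʳ)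
open import Data.Product using (∃; _×_; _,_; proj₁; proj₂)
open import Data.Sum using (_⊎_)
open import Data.Empty using (⊥-elim)
open import Function.Bundles using (_⇔_; mk⇔)
open import Relation.Nullary using (yes; no; contradiction)
open import Relation.Binary.PropositionalEquality
  using (_≡_; refl; sym; trans; cong; subst; module ≡-Reasoning)

module _ {k : ℕ} (M : TBS k) where
  open TBS M

  prefix-suc : (ρ : Path M) (i : ℕ) →
               prefix M ρ (suc i) ≡ (proj₁ (prefix M ρ i) ∷ʳ ρ i , ρ (suc i))
  prefix-suc ρ i = cong (_, ρ (suc i)) (begin
    map ρ (upTo (suc i))      ≡⟨ cong (map ρ) (upTo-∷ʳ i) ⟨
    map ρ (upTo i ∷ʳ i)       ≡⟨ map-++ ρ (upTo i) _ ⟩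
    map ρ (upTo i) ∷ʳ ρ i     ∎)
    where open ≡-Reasoning

  -- Agents outside A have a single action, so the structure chooses for them.
  next : {A : Coalition k} → Profile M A →
         (h : History M) → ∃ λ q′ → q′ ∈ Succ (proj₂ h)
  next {A} σ h with AgSt (proj₂ h) ∈? A
  ... | yes a∈A = σ _ a∈A h refl
  ... | no  _   = Succ-ne (proj₂ h)

  next-member : {A : Coalition k} (σ : Profile M A) (h : History M)
                (a∈A : AgSt (proj₂ h) ∈ A) → next σ h ≡ σ _ a∈A h refl
  next-member {A} σ h a∈A with AgSt (proj₂ h) ∈? A
  ... | yes a∈A′ = cong (λ m → σ _ m h refl) ([]=-irrelevant a∈A′ a∈A)
  ... | no  a∉A  = contradiction a∈A a∉A

  play : {A : Coalition k} → Profile M A → State M → ℕ → History M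
  play σ q zero    = [] , q
  play σ q (suc i) = proj₁ (play σ q i) ∷ʳ proj₂ (play σ q i) , proj₁ (next σ (play σ q i))

  outcome : {A : Coalition k} → Profile M A → State M → Path M
  outcome σ q i = proj₂ (play σ q i)

  play≡prefix : {A : Coalition k} (σ : Profile M A) (q : State M) (i : ℕ) →
                play σ q i ≡ prefix M (outcome σ q) i
  play≡prefix σ q zero    = refl
  play≡prefix σ q (suc i) = trans
    (cong (λ h → proj₁ h ∷ʳ outcome σ q i , outcome σ q (suc i)) (play≡prefix σ q i))
    (sym (prefix-suc (outcome σ q) i))

  outcome-consistent : {A : Coalition k} (σ : Profile M A) (q : State M) →
                       Consistent M A σ q (outcome σ q)
  outcome-consistent σ q = refl , step , follows
    where
    step : ∀ i → outcome σ q (suc i) ∈ Succ (outcome σ q i)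
    step i = proj₂ (next σ (play σ q i))

    follows : ∀ i (a∈A : AgSt (outcome σ q i) ∈ _) →
              outcome σ q (suc i) ≡ proj₁ (σ _ a∈A (prefix M (outcome σ q) i) refl)
    follows i a∈A rewrite play≡prefix σ q i = cong proj₁ (next-member σ _ a∈A)

  Enforce⇒outcome : {A : Coalition k} {q : State M} {ψ : Path M → Set} →
                    Enforce M A q ψ → ∃ λ ρ → ρ 0 ≡ q × ψ ρ
  Enforce⇒outcome {q = q} (σ , win) =
    outcome σ q , refl , win _ (outcome-consistent σ q)

  Consistent-⊥ : (σ : Profile M ⊥) {q : State M} {ρ : Path M} → ρ 0 ≡ q →
                 (∀ i → ρ (suc i) ∈ Succ (ρ i)) → Consistent M ⊥ σ q ρ
  Consistent-⊥ σ ρ0≡q step = ρ0≡q , step , λ _ a∈⊥ → ⊥-elim (∉⊥ a∈⊥)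

  ⟪⟫G⇒⊨ : {A : Coalition k} (φ : Formula k) {q : State M} →
          _⊨_ M q (⟪ A ⟫G φ) → _⊨_ M q φ
  ⟪⟫G⇒⊨ φ q⊨Gφ with Enforce⇒outcome q⊨Gφ
  ... | _ , ρ0≡q , Gφ = subst (λ s → _⊨_ M s φ) ρ0≡q (Gφ 0)

  module _ (loop : (q : State M) → q ∈ Succ q) where

    stay : (A : Coalition k) → Profile M A
    stay A _ _ h _ = proj₂ h , loop (proj₂ h)

    stay-⊤-constant : {q : State M} {ρ : Path M} →
                      Consistent M ⊤ (stay ⊤) q ρ → ∀ i → ρ i ≡ q
    stay-⊤-constant (ρ0≡q , _)       zero    = ρ0≡q
    stay-⊤-constant c@(_ , _ , ρ-stays) (suc i) =
      trans (ρ-stays i ∈⊤) (stay-⊤-constant c i)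

    ⊨⇒⟪⟫F : (A : Coalition k) (φ : Formula k) {q : State M} →
            _⊨_ M q φ → _⊨_ M q (⟪ A ⟫F φ)
    ⊨⇒⟪⟫F A φ q⊨φ = stay A , λ _ (ρ0≡q , _) → 0 , subst (λ s → _⊨_ M s φ) (sym ρ0≡q) q⊨φ

    ⟪⊥⟫F⇒⊨ : (φ : Formula k) {q : State M} → _⊨_ M q (⟪ ⊥ ⟫F φ) → _⊨_ M q φ
    ⟪⊥⟫F⇒⊨ φ {q} (σ , win) = proj₂ (win (λ _ → q) (Consistent-⊥ σ refl (λ _ → loop q)))

    ⊨⇒⟪⊤⟫G : (φ : Formula k) {q : State M} → _⊨_ M q φ → _⊨_ M q (⟪ ⊤ ⟫G φ)
    ⊨⇒⟪⊤⟫G φ q⊨φ = stay ⊤ , λ _ c i → subst (λ s → _⊨_ M s φ) (sym (stay-⊤-constant c i)) q⊨φ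

lemma34 : (k : ℕ) → (k ≡ 2 ⊎ k ≡ 3) → (φ : Formula k) →
    (M : TBS k) → SelfLooping M → (q : State M) →
    ((_⊨_ M q φ) ⇔ (_⊨_ M q (⟪ ⊥ ⟫F φ)))
    × ((_⊨_ M q φ) ⇔ (_⊨_ M q (⟪ ⊤ ⟫G φ)))
lemma34 k _ φ M (_ , loop) q =
    mk⇔ (⊨⇒⟪⟫F M loop ⊥ φ) (⟪⊥⟫F⇒⊨ M loop φ)
  , mk⇔ (⊨⇒⟪⊤⟫G M loop φ) (⟪⟫G⇒⊨ M φ)
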